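{- For all integers $h\ge 2$ and $k\ge 2$, every deterministic thrifty $k$-way branching program solving $BT^h_2(k)$ has at least $k^h$ states.
   Context: Let $[k]=\{1,\dots,k\}$. $T^h_2$ is the balanced rooted binary tree with $h$ levels (height counts levels), nodes numbered heap-style: root $1$, children of node $i$ are $2i$ and $2i+1$. An instance with parameter $k$ assigns to each internal node $i$ a function $f_i:[k]^2\to[k]$ (given by its $k^2$ values) and to each leaf an element of $[k]$. Values: $v_i$ is the leaf label for a leaf, and $v_i=f_i(v_{2i},v_{2i+1})$ for an internal node. $BT^h_2(k)$ is the problem of deciding whether $v_1=1$. The $k$-ary input variables are $f_i(a,b)$ for internal $i$ and $a,b\in[k]$, plus one variable per leaf. A deterministic $k$-way branching program computing $g:[k]^m\to R$ is a directed rooted multigraph of states; each nonfinal state is labelled by a variable index in $[m]$ and has exactly $k$ outedges labelled $1,\dots,k$; there are $|R|$ final sink states labelled by elements of $R$; on input $x$ the computation starts at the root and from a state labelled $j$ follows the edge labelled $x_j$; it must reach the final state labelled $g(x)$. It solves a decision problem if it computes its characteristic function. Such a program solving $BT^h_2(k)$ is thrifty if, on every input, every query to a variable $f_i(a,b)$ of an internal node $i$ made during the computation satisfies $(a,b)=(v_{2i},v_{2i+1})$, the correct values of the children of $i$ on that input. -}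

module Defs where

open import Data.Nat using (ℕ; zero; suc; _+_; _*_; _∸_; _^_; _≤_; _<_)
open import Data.Nat.Logarithm using (⌊log₂_⌋)
open import Data.Fin using (Fin; zero; suc)
open import Data.Bool using (Bool; false)
open import Data.Sum using (_⊎_; inj₁; inj₂)
open import Data.Product using (Σ; ∃; _×_; _,_)
open import Relation.Binary.PropositionalEquality using (_≡_)
open import Relation.Nullary.Decidable using (⌊_⌋)
open import Data.Fin using (_≟_)

-- Nodes are heap-numbered naturals:
-- root 1, children of i are 2i and 2i+1.  With h levels, the internal
-- nodes are 1 ≤ i < 2^(h-1) and the leaves are 2^(h-1) ≤ i < 2^h.
-- The element j ∈ [k] is represented by Fin k (j ↦ j-1); so the value
-- "1" of [k] is the Fin element zero.

data Var (h k : ℕ) : Set where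
  fvar : (i : ℕ) → 1 ≤ i → i < 2 ^ (h ∸ 1) → Fin k → Fin k → Var h k
  lvar : (i : ℕ) → 2 ^ (h ∸ 1) ≤ i → i < 2 ^ h → Var h k

-- An instance: node functions f_i and leaf labels.  (Values at indices
-- outside the relevant range are never read.)
record Instance (k : ℕ) : Set where
  field
    fun  : ℕ → Fin k → Fin k → Fin k
    leaf : ℕ → Fin k
open Instance public

read : ∀ {h k} → Instance k → Var h k → Fin k
read I (fvar i _ _ a b) = fun I i a b
read I (lvar i _ _)     = leaf I i

-- valAt r i : value of node i when node i has r levels strictly below it.
valAt : ∀ {k} → Instance k → ℕ → ℕ → Fin k
valAt I zero    i = leaf I i
valAt I (suc r) i = fun I i (valAt I r (2 * i)) (valAt I r (2 * i + 1))

-- level of node i (root has level 1)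
level : ℕ → ℕ
level i = suc ⌊log₂ i ⌋

val : ∀ {k} → (h : ℕ) → Instance k → ℕ → Fin k
val h I i = valAt I (h ∸ level i) i

BT : ∀ {k} → (h : ℕ) → Instance k → Bool
BT {suc k} h I = ⌊ val h I 1 ≟ zero ⌋
BT {zero}  h I = false

-- A state labelled inj₁ x is nonfinal, queries variable x, and has the
-- k outedges  edge s c  (c : Fin k).  A state labelled inj₂ r is a final
-- (sink) state labelled r; its 'edge' entries are ignored.
record BP (h k n : ℕ) : Set where
  field
    root  : Fin n
    label : Fin n → Var h k ⊎ Bool
    edge  : Fin n → Fin k → Fin n
    finalExists : ∀ r → ∃ λ s → label s ≡ inj₂ r
    finalUnique : ∀ r s t → label s ≡ inj₂ r → label t ≡ inj₂ r → s ≡ t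
open BP public

step : ∀ {h k n} → BP h k n → Instance k → Fin n → Fin n
step P I s with label P s
... | inj₁ x = edge P s (read I x)
... | inj₂ _ = s

run : ∀ {h k n} → BP h k n → Instance k → ℕ → Fin n
run P I zero    = root P
run P I (suc t) = step P I (run P I t)

Solves : ∀ {h k n} → BP h k n → Set
Solves {h} P = ∀ I → ∃ λ t → label P (run P I t) ≡ inj₂ (BT h I)

Thrifty : ∀ {h k n} → BP h k n → Set
Thrifty {h} P = ∀ I t i p q a b →
  label P (run P I t) ≡ inj₁ (fvar i p q a b) →
  (a ≡ val h I (2 * i)) × (b ≡ val h I (2 * i + 1))

module Submission where

-- Fix such a program P.  On input I, the child c of a node p is held at
-- time t if f_p is queried at some time u ≥ t while c is not queried
-- during [t, u]; by thriftiness that query has argument v_c, so the state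
-- at time t must determine v_c.  The proof has three steps.
--  (1) Agreement: two inputs reaching the same state, and differing only
--      at the value positions of pebbles they hold, are equal.  The two
--      computations proceed in lockstep, and a downward induction over
--      the tree shows that each held value is forced by the state.
--  (2) Critical time: for every input there is a time at which h pebbles
--      with distinct nodes are held.  This is a pebbling argument, using
--      that children are queried before their parents and that the root
--      function must be queried.
--  (3) Counting: (I , c) ↦ (state of I at its critical time, I with the
--      values at its critical pebbles replaced by c ∈ [k]^h) is injective
--      by (1), so |inputs| · k^h ≤ n · |inputs|.

open import Defs
open import Data.Nat using (ℕ; zero; suc; _+_; _*_; _∸_; _^_; _≤_; _<_; z≤n; s≤s; _<?_; ⌊_/2⌋)
open import Data.Nat.Logarithm using (⌊log₂_⌋; ⌊log₂⌋-mono-≤; ⌊log₂⌊n/2⌋⌋≡⌊log₂n⌋∸1; ⌊log₂[2^n]⌋≡n)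
open import Data.Nat.Properties
open import Data.Nat.Induction using (<-rec)
open import Data.Fin using (Fin; zero; suc)
open import Data.Fin.Properties using (any?) renaming (_≟_ to _F≟_; suc-injective to Fin-suc-injective)
open import Data.Nat using () renaming (_≟_ to _ℕ≟_)
open import Data.Fin.Properties using (*↔×; injective⇒≤; nonZeroIndex)
open import Data.Vec using (Vec; []; _∷_; lookup; tabulate; replicate; updateAt; _[_]≔_; map)
open import Data.Vec.Properties using (lookup-map; tabulate∘lookup; tabulate-cong; lookup∘updateAt; lookup∘updateAt′; lookup∘update; lookup∘update′)
open import Data.Bool using (Bool)
open import Data.Sum using (_⊎_; inj₁; inj₂; [_,_])
open import Data.Sum.Properties using (inj₂-injective)
open import Data.Product using (Σ; ∃; _×_; _,_; proj₁; proj₂; uncurry)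
open import Data.Product.Function.NonDependent.Propositional using (_×-↔_)
open import Data.Empty using (⊥; ⊥-elim)
open import Function using (_∘_)
open import Function.Bundles using (_↔_; Inverse; mk↔ₛ′; Injection)
open import Function.Definitions using (Injective)
open import Function.Properties.Inverse using (↔-refl; ↔-sym; ↔-trans; Inverse⇒Injection)
open import Relation.Nullary using (¬_; Dec; yes; no; ¬?; _×-dec_; _⊎-dec_; _→-dec_)
open import Relation.Nullary.Decidable using (⌊_⌋; decidable-stable)
open import Relation.Unary using (Decidable)
open import Relation.Binary.Definitions using (DecidableEquality)
open import Relation.Binary.PropositionalEquality hiding ([_])

data Side : Set where
  L R : Side

opposite : Side → Side
opposite L = R
opposite R = L

opposite-≢ : ∀ s → s ≢ opposite s
opposite-≢ L ()
opposite-≢ R ()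

child : ℕ → Side → ℕ
child p L = 2 * p
child p R = 2 * p + 1

half-child : ∀ p s → ⌊ child p s /2⌋ ≡ p
half-child p L rewrite +-identityʳ p = sym (n≡⌊n+n/2⌋ p)
half-child p R rewrite +-identityʳ p | +-comm (p + p) 1 = sym (n≡⌈n+n/2⌉ p)

level-half : ∀ n → 2 ≤ n → level n ≡ suc (level ⌊ n /2⌋)
level-half n 2≤n = cong suc (begin
  ⌊log₂ n ⌋                 ≡⟨ sym (m∸n+n≡m 1≤log) ⟩
  ⌊log₂ n ⌋ ∸ 1 + 1         ≡⟨ +-comm (⌊log₂ n ⌋ ∸ 1) 1 ⟩
  suc (⌊log₂ n ⌋ ∸ 1)       ≡⟨ cong suc (sym (⌊log₂⌊n/2⌋⌋≡⌊log₂n⌋∸1 n)) ⟩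
  suc ⌊log₂ ⌊ n /2⌋ ⌋       ∎)
  where
  open ≡-Reasoning
  1≤log : 1 ≤ ⌊log₂ n ⌋
  1≤log = ⌊log₂⌋-mono-≤ 2≤n

child-pos : ∀ p s → 1 ≤ p → 1 ≤ child p s
child-pos p L 1≤p = ≤-trans 1≤p (m≤m+n p (p + 0))
child-pos p R 1≤p = ≤-trans (child-pos p L 1≤p) (m≤m+n (2 * p) 1)

parent<child : ∀ p s → 1 ≤ p → p < child p s
parent<child p s 1≤p = subst (_< child p s) (half-child p s)
  (⌊n/2⌋<n' (child p s) (child-pos p s 1≤p))
  where
  ⌊n/2⌋<n' : ∀ n → 1 ≤ n → ⌊ n /2⌋ < n
  ⌊n/2⌋<n' (suc n) _ = ⌊n/2⌋<n n

level-child : ∀ p s → 1 ≤ p → level (child p s) ≡ suc (level p)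
level-child p s 1≤p = trans (level-half (child p s) (≤-<-trans 1≤p (parent<child p s 1≤p)))
                            (cong (λ m → suc (level m)) (half-child p s))

child-injective : ∀ p p' s s' → child p s ≡ child p' s' → p ≡ p' × s ≡ s'
child-injective p p' s s' e with trans (sym (half-child p s)) (trans (cong ⌊_/2⌋ e) (half-child p' s'))
child-injective p .p L L e | refl = refl , refl
child-injective p .p R R e | refl = refl , refl
child-injective p .p L R e | refl = ⊥-elim (1+n≢n (sym (trans e (+-comm (2 * p) 1))))
child-injective p .p R L e | refl = ⊥-elim (1+n≢n (trans (+-comm 1 (2 * p)) e))

child< : ∀ p s {B} → p < B → child p s < 2 * B
child< p L     p<B = *-monoʳ-< 2 p<B
child< p R {B} p<B = ≤-trans (≤-reflexive 2p+2≡2[p+1]) (*-monoʳ-≤ 2 p<B)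
  where
  2p+2≡2[p+1] : suc (2 * p + 1) ≡ 2 * suc p
  2p+2≡2[p+1] = trans (cong suc (+-comm (2 * p) 1)) (sym (*-suc 2 p))

Desc : ℕ → ℕ → ℕ → Set
Desc m zero    a = m ≡ a
Desc m (suc d) a = Σ Side λ s → Desc m d (child a s)

Desc-unique : ∀ m d a b → Desc m d a → Desc m d b → a ≡ b
Desc-unique m zero    a b e₁ e₂ = trans (sym e₁) e₂
Desc-unique m (suc d) a b (s , x) (s' , y) =
  proj₁ (child-injective a b s s' (Desc-unique m d _ _ x y))

Desc-level : ∀ m d a → 1 ≤ a → Desc m d a → level m ≡ d + level a
Desc-level m zero    a _   e       = cong level e
Desc-level m (suc d) a 1≤a (s , x) = begin
  level m                     ≡⟨ Desc-level m d (child a s) (child-pos a s 1≤a) x ⟩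
  d + level (child a s)       ≡⟨ cong (d +_) (level-child a s 1≤a) ⟩
  d + suc (level a)           ≡⟨ +-suc d (level a) ⟩
  suc d + level a             ∎
  where open ≡-Reasoning

subtrees-disjoint : ∀ {m d d' a s s'} → 1 ≤ a → s ≢ s' →
                    Desc m d (child a s) → Desc m d' (child a s') → ⊥
subtrees-disjoint {m} {d} {d'} {a} {s} {s'} 1≤a s≢s' x y =
  s≢s' (proj₂ (child-injective a a s s' (Desc-unique m d _ _ x y')))
  where
  same-depth : d ≡ d'
  same-depth = +-cancelʳ-≡ (level (child a s)) d d' (begin
    d + level (child a s)     ≡⟨ sym (Desc-level m d _ (child-pos a s 1≤a) x) ⟩
    level m                   ≡⟨ Desc-level m d' _ (child-pos a s' 1≤a) y ⟩
    d' + level (child a s')   ≡⟨ cong (d' +_) (trans (level-child a s' 1≤a) (sym (level-child a s 1≤a))) ⟩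
    d' + level (child a s)    ∎)
    where open ≡-Reasoning
  y' : Desc m d (child a s')
  y' = subst (λ e → Desc m e (child a s')) (sym same-depth) y

×↔Fin : ∀ {X Y : Set} {x y} → X ↔ Fin x → Y ↔ Fin y → (X × Y) ↔ Fin (x * y)
×↔Fin X↔ Y↔ = ↔-trans (X↔ ×-↔ Y↔) (↔-sym *↔×)

Vec↔Fin : ∀ {X : Set} {x} m → X ↔ Fin x → Vec X m ↔ Fin (x ^ m)
Vec↔Fin zero    _  = mk↔ₛ′ (λ _ → zero) (λ _ → []) (λ { zero → refl }) (λ { [] → refl })
Vec↔Fin (suc m) X↔ = ↔-trans uncons↔ (×↔Fin X↔ (Vec↔Fin m X↔))
  where
  uncons↔ : Vec _ (suc m) ↔ (_ × Vec _ m)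
  uncons↔ = mk↔ₛ′ (λ { (x ∷ xs) → x , xs }) (uncurry _∷_) (λ _ → refl) (λ { (x ∷ xs) → refl })

-- The counting principle behind the lower bound: an injection
-- A × V → Fin c × A of finite sets, with A inhabited, forces |V| ≤ c,
-- since it is an injection Fin (a * v) → Fin (c * a).
counting : ∀ {A V : Set} {a v c} → A ↔ Fin a → V ↔ Fin v → A →
           (Φ : A × V → Fin c × A) → Injective _≡_ _≡_ Φ → v ≤ c
counting {a = a} {v} {c} A↔ V↔ α Φ Φ-inj =
  *-cancelˡ-≤ a {{nonZeroIndex (Inverse.to A↔ α)}}
    (≤-trans (injective⇒≤ code-injective) (≤-reflexive (*-comm c a)))
  where
  decode : Injection _ _
  decode = Inverse⇒Injection (↔-sym (×↔Fin A↔ V↔))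
  encode : Injection _ _
  encode = Inverse⇒Injection (×↔Fin (↔-refl {A = Fin c}) A↔)
  code : Fin (a * v) → Fin (c * a)
  code = Injection.to encode ∘ Φ ∘ Injection.to decode
  code-injective : Injective _≡_ _≡_ code
  code-injective e = Injection.injective decode (Φ-inj (Injection.injective encode e))

∸-suc-≤ : ∀ m d → m ∸ d ≤ suc (m ∸ suc d)
∸-suc-≤ zero    zero    = z≤n
∸-suc-≤ zero    (suc d) = z≤n
∸-suc-≤ (suc m) zero    = ≤-refl
∸-suc-≤ (suc m) (suc d) = ∸-suc-≤ m d

switch : ∀ {Q : ℕ → Set} → Decidable Q → ∀ N → ¬ Q 0 → Q N →
         ∃ λ t → t < N × ¬ Q t × Q (suc t)
switch Q? zero    ¬Q0 QN = ⊥-elim (¬Q0 QN)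
switch Q? (suc N) ¬Q0 QN with Q? N
... | no ¬QN = N , ≤-refl , ¬QN , QN
... | yes QN′ with switch Q? N ¬Q0 QN′
...   | t , t<N , ¬Qt , Qt+1 = t , m≤n⇒m≤1+n t<N , ¬Qt , Qt+1

atℕ : ∀ {X : Set} {m} → X → Vec X m → ℕ → X
atℕ d []       i       = d
atℕ d (x ∷ xs) zero    = x
atℕ d (x ∷ xs) (suc i) = atℕ d xs i

updateAtℕ : ∀ {X : Set} {m} → Vec X m → ℕ → (X → X) → Vec X m
updateAtℕ []       i       f = []
updateAtℕ (x ∷ xs) zero    f = f x ∷ xs
updateAtℕ (x ∷ xs) (suc i) f = x ∷ updateAtℕ xs i f

atℕ-updateAtℕ : ∀ {X : Set} {m} d (xs : Vec X m) i f → i < m → atℕ d (updateAtℕ xs i f) i ≡ f (atℕ d xs i)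
atℕ-updateAtℕ d (x ∷ xs) zero    f _   = refl
atℕ-updateAtℕ d (x ∷ xs) (suc i) f i<m = atℕ-updateAtℕ d xs i f (≤-pred i<m)

atℕ-updateAtℕ′ : ∀ {X : Set} {m} d (xs : Vec X m) i j f → j ≢ i → atℕ d (updateAtℕ xs i f) j ≡ atℕ d xs j
atℕ-updateAtℕ′ d []       i       j       f _   = refl
atℕ-updateAtℕ′ d (x ∷ xs) zero    zero    f j≢i = ⊥-elim (j≢i refl)
atℕ-updateAtℕ′ d (x ∷ xs) zero    (suc j) f _   = refl
atℕ-updateAtℕ′ d (x ∷ xs) (suc i) zero    f _   = refl
atℕ-updateAtℕ′ d (x ∷ xs) (suc i) (suc j) f j≢i = atℕ-updateAtℕ′ d xs i j f (j≢i ∘ cong suc)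

atℕ-ext : ∀ {X : Set} {m} d (xs ys : Vec X m) → (∀ i → i < m → atℕ d xs i ≡ atℕ d ys i) → xs ≡ ys
atℕ-ext d []       []       _  = refl
atℕ-ext d (x ∷ xs) (y ∷ ys) eq = cong₂ _∷_ (eq 0 (s≤s z≤n)) (atℕ-ext d xs ys λ i i<m → eq (suc i) (s≤s i<m))

lookup-ext : ∀ {X : Set} {m} (xs ys : Vec X m) → (∀ j → lookup xs j ≡ lookup ys j) → xs ≡ ys
lookup-ext xs ys eq = trans (sym (tabulate∘lookup xs)) (trans (tabulate-cong eq) (tabulate∘lookup ys))

module Inputs (h k : ℕ) where

  Label : Set
  Label = Var h k ⊎ Bool

  queriedNode : Label → ℕ
  queriedNode (inj₁ (fvar i _ _ _ _)) = i
  queriedNode (inj₁ (lvar i _ _))     = i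
  queriedNode (inj₂ _)                = 0

  data Pos : Set where
    fpos : ℕ → Fin k → Fin k → Pos
    lpos : ℕ → Pos

  get : Instance k → Pos → Fin k
  get I (fpos i a b) = fun I i a b
  get I (lpos i)     = leaf I i

  posNode : Pos → ℕ
  posNode (fpos i _ _) = i
  posNode (lpos i)     = i

  pos : Var h k → Pos
  pos (fvar i _ _ a b) = fpos i a b
  pos (lvar i _ _)     = lpos i

  read-pos : ∀ I x → read I x ≡ get I (pos x)
  read-pos I (fvar _ _ _ _ _) = refl
  read-pos I (lvar _ _ _)     = refl

  queriedNode-pos : ∀ x → queriedNode (inj₁ x) ≡ posNode (pos x)
  queriedNode-pos (fvar _ _ _ _ _) = refl
  queriedNode-pos (lvar _ _ _)     = refl

  _≟P_ : DecidableEquality Pos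
  fpos i a b ≟P fpos j c d with i ℕ≟ j | a F≟ c | b F≟ d
  ... | yes refl | yes refl | yes refl = yes refl
  ... | no i≢j   | _        | _        = no λ { refl → i≢j refl }
  ... | yes _    | no a≢c   | _        = no λ { refl → a≢c refl }
  ... | yes _    | yes _    | no b≢d   = no λ { refl → b≢d refl }
  fpos _ _ _ ≟P lpos _ = no λ ()
  lpos _ ≟P fpos _ _ _ = no λ ()
  lpos i ≟P lpos j with i ℕ≟ j
  ... | yes refl = yes refl
  ... | no i≢j   = no λ { refl → i≢j refl }

  overwrite : Pos → Fin k → Pos → Fin k → Fin k
  overwrite p v q old with q ≟P p
  ... | yes _ = v
  ... | no _  = old

  modify : Instance k → Pos → Fin k → Instance k
  modify I p v = record { fun  = λ i a b → overwrite p v (fpos i a b) (fun I i a b)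
                        ; leaf = λ i → overwrite p v (lpos i) (leaf I i) }

  get-modify : ∀ I p v q → get (modify I p v) q ≡ overwrite p v q (get I q)
  get-modify I p v (fpos _ _ _) = refl
  get-modify I p v (lpos _)     = refl

  get-modify-same : ∀ I p v → get (modify I p v) p ≡ v
  get-modify-same I p v rewrite get-modify I p v p with p ≟P p
  ... | yes _   = refl
  ... | no p≢p = ⊥-elim (p≢p refl)

  get-modify-other : ∀ I p v q → q ≢ p → get (modify I p v) q ≡ get I q
  get-modify-other I p v q q≢p rewrite get-modify I p v q with q ≟P p
  ... | yes q≡p = ⊥-elim (q≢p q≡p)
  ... | no _    = refl

  -- I and J agree at all nodes numbered above m, in particular on the
  -- whole subtree strictly below m
  AgreeAbove : Instance k → Instance k → ℕ → Set
  AgreeAbove I J m = ∀ p → m < posNode p → get I p ≡ get J p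

  modify-agreeAbove : ∀ I p v → AgreeAbove (modify I p v) I (posNode p)
  modify-agreeAbove I p v q p<q = get-modify-other I p v q λ { refl → <-irrefl refl p<q }

  valAt-agree : ∀ I J m → AgreeAbove I J m → ∀ r i → m < i → valAt I r i ≡ valAt J r i
  valAt-agree I J m agree zero    i m<i = agree (lpos i) m<i
  valAt-agree I J m agree (suc r) i m<i =
    trans (cong₂ (fun I i) (valAt-agree I J m agree r (child i L) (<-≤-trans m<i (m≤child i L)))
                           (valAt-agree I J m agree r (child i R) (<-≤-trans m<i (m≤child i R))))
          (agree (fpos i _ _) m<i)
    where
    m≤child : ∀ i s → i ≤ child i s
    m≤child i L = m≤m+n i (i + 0)
    m≤child i R = ≤-trans (m≤m+n i (i + 0)) (m≤m+n (2 * i) 1)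

  val-agree : ∀ (I J : Instance k) m → AgreeAbove I J m → ∀ s → 1 ≤ m →
              val h I (child m s) ≡ val h J (child m s)
  val-agree I J m agree s 1≤m = valAt-agree I J m agree (h ∸ level (child m s)) (child m s) (parent<child m s 1≤m)

  val-internal : ∀ (I : Instance k) m → 1 ≤ m → level m < h →
                 val h I m ≡ fun I m (val h I (child m L)) (val h I (child m R))
  val-internal I m 1≤m lm<h =
    trans (cong (λ r → valAt I r m) (+-∸-assoc 1 {h} {suc (level m)} lm<h))
          (cong₂ (fun I m) (children L) (children R))
    where
    children : ∀ s → valAt I (h ∸ suc (level m)) (child m s) ≡ val h I (child m s)
    children s = cong (λ l → valAt I (h ∸ l) (child m s)) (sym (level-child m s 1≤m))

  val-leaf : ∀ (I : Instance k) m → h ≤ level m → val h I m ≡ leaf I m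
  val-leaf I m h≤lm = cong (λ r → valAt I r m) (m≤n⇒m∸n≡0 h≤lm)

  valuePosBy : Instance k → (m : ℕ) → Dec (level m < h) → Pos
  valuePosBy I m (yes _) = fpos m (val h I (child m L)) (val h I (child m R))
  valuePosBy I m (no _)  = lpos m

  valuePos : Instance k → ℕ → Pos
  valuePos I m = valuePosBy I m (level m <? h)

  posNode-valuePos : ∀ I m → posNode (valuePos I m) ≡ m
  posNode-valuePos I m with level m <? h
  ... | yes _ = refl
  ... | no _  = refl

  val-valuePos : ∀ (X Y : Instance k) m → 1 ≤ m → (∀ s → val h X (child m s) ≡ val h Y (child m s)) →
                 val h X m ≡ get X (valuePos Y m)
  val-valuePos X Y m 1≤m children with level m <? h
  ... | yes lm<h = trans (val-internal X m 1≤m lm<h) (cong₂ (fun X m) (children L) (children R))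
  ... | no  lm≮h = val-leaf X m (≮⇒≥ lm≮h)

  val-valuePos-above : ∀ (X Y : Instance k) m → 1 ≤ m → AgreeAbove X Y m → val h X m ≡ get X (valuePos Y m)
  val-valuePos-above X Y m 1≤m agree = val-valuePos X Y m 1≤m (λ s → val-agree X Y m agree s 1≤m)

module Runs {h k n : ℕ} (P : BP h k n) where

  open Inputs h k

  step-final : ∀ I s r → label P s ≡ inj₂ r → step P I s ≡ s
  step-final I s r eq rewrite eq = refl

  AgreeAt : Instance k → Instance k → Fin n → Set
  AgreeAt I J s = ∀ x → label P s ≡ inj₁ x → read I x ≡ read J x

  step-agree : ∀ I J s → AgreeAt I J s → step P I s ≡ step P J s
  step-agree I J s agree with label P s
  ... | inj₁ x = cong (edge P s) (agree x refl)
  ... | inj₂ _ = refl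

  run-+suc : ∀ I t d → run P I (t + suc d) ≡ step P I (run P I (t + d))
  run-+suc I t d rewrite +-suc t d = refl

  stay-together : ∀ I J tI tJ d → run P I tI ≡ run P J tJ →
                  (∀ w → w < d → AgreeAt I J (run P I (tI + w))) →
                  run P I (tI + d) ≡ run P J (tJ + d)
  stay-together I J tI tJ zero same _
    rewrite +-identityʳ tI | +-identityʳ tJ = same
  stay-together I J tI tJ (suc d) same agree = begin
    run P I (tI + suc d)          ≡⟨ run-+suc I tI d ⟩
    step P I (run P I (tI + d))   ≡⟨ step-agree I J _ (agree d ≤-refl) ⟩
    step P J (run P I (tI + d))   ≡⟨ cong (step P J) together ⟩
    step P J (run P J (tJ + d))   ≡⟨ sym (run-+suc J tJ d) ⟩
    run P J (tJ + suc d)          ∎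
    where
    open ≡-Reasoning
    together = stay-together I J tI tJ d same (λ w w<d → agree w (m≤n⇒m≤1+n w<d))

  modify-unqueried : ∀ I q v u → (∀ w → w < u → queriedNode (label P (run P I w)) ≢ posNode q) →
                     run P I u ≡ run P (modify I q v) u
  modify-unqueried I q v u unqueried = stay-together I (modify I q v) 0 0 u refl agree
    where
    agree : ∀ w → w < u → AgreeAt I (modify I q v) (run P I w)
    agree w w<u x eq = begin
      read I x                     ≡⟨ read-pos I x ⟩
      get I (pos x)                ≡⟨ sym (get-modify-other I q v (pos x) px≢q) ⟩
      get (modify I q v) (pos x)   ≡⟨ sym (read-pos (modify I q v) x) ⟩
      read (modify I q v) x        ∎
      where
      open ≡-Reasoning
      px≢q : pos x ≢ q
      px≢q e = unqueried w w<u (trans (cong queriedNode eq) (trans (queriedNode-pos x) (cong posNode e)))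

  final-sink : ∀ I t r d → label P (run P I t) ≡ inj₂ r → run P I (t + d) ≡ run P I t
  final-sink I t r zero    eq = cong (run P I) (+-identityʳ t)
  final-sink I t r (suc d) eq = begin
    run P I (t + suc d)          ≡⟨ run-+suc I t d ⟩
    step P I (run P I (t + d))   ≡⟨ cong (step P I) (final-sink I t r d eq) ⟩
    step P I (run P I t)         ≡⟨ step-final I _ r eq ⟩
    run P I t                    ∎
    where open ≡-Reasoning

  answer-unique-≤ : ∀ I {a b r r'} → a ≤ b → label P (run P I a) ≡ inj₂ r →
                    label P (run P I b) ≡ inj₂ r' → r ≡ r'
  answer-unique-≤ I {a} {b} {r} a≤b ea eb = inj₂-injective (begin
    inj₂ r                            ≡⟨ sym ea ⟩
    label P (run P I a)               ≡⟨ cong (label P) (sym (final-sink I a r (b ∸ a) ea)) ⟩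
    label P (run P I (a + (b ∸ a)))   ≡⟨ cong (label P ∘ run P I) (m+[n∸m]≡n a≤b) ⟩
    label P (run P I b)               ≡⟨ eb ⟩
    inj₂ _                            ∎)
    where open ≡-Reasoning

  answer-unique : ∀ I a b {r r'} → label P (run P I a) ≡ inj₂ r →
                  label P (run P I b) ≡ inj₂ r' → r ≡ r'
  answer-unique I a b ea eb with ≤-total a b
  ... | inj₁ a≤b = answer-unique-≤ I a≤b ea eb
  ... | inj₂ b≤a = sym (answer-unique-≤ I b≤a eb ea)

module LowerBound (h k' n : ℕ) (P : BP h (suc (suc k')) n) (2≤h : 2 ≤ h)
                  (solves : Solves P) (thrifty : Thrifty P) where

  k : ℕ
  k = suc (suc k')

  open Inputs h k
  open Runs P

  -- a value different from x (here k ≥ 2 is used)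
  flip : Fin k → Fin k
  flip zero    = suc zero
  flip (suc _) = zero

  flip-≢ : ∀ x → flip x ≢ x
  flip-≢ zero    ()
  flip-≢ (suc _) ()

  record FunQuery (l : Label) (p : ℕ) : Set where
    field
      1≤p      : 1 ≤ p
      p<       : p < 2 ^ (h ∸ 1)
      arg₁     : Fin k
      arg₂     : Fin k
      is-query : l ≡ inj₁ (fvar p 1≤p p< arg₁ arg₂)

  funQuery? : ∀ l p → Dec (FunQuery l p)
  funQuery? (inj₁ (fvar i 1≤i i< a b)) p with i ℕ≟ p
  ... | yes refl = yes (record { 1≤p = 1≤i ; p< = i< ; arg₁ = a ; arg₂ = b ; is-query = refl })
  ... | no i≢p   = no λ { record { is-query = refl } → i≢p refl }
  funQuery? (inj₁ (lvar _ _ _)) p = no λ where record { is-query = () }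
  funQuery? (inj₂ _)            p = no λ where record { is-query = () }

  queriedNode-funQuery : ∀ {l p} → FunQuery l p → queriedNode l ≡ p
  queriedNode-funQuery record { is-query = refl } = refl

  leaf-level : ∀ j → 2 ^ (h ∸ 1) ≤ j → h ≤ level j
  leaf-level j 2^h-1≤j = begin
    h                       ≡⟨ sym (m∸n+n≡m (≤-trans (s≤s z≤n) 2≤h)) ⟩
    h ∸ 1 + 1               ≡⟨ +-comm (h ∸ 1) 1 ⟩
    suc (h ∸ 1)             ≡⟨ cong suc (sym (⌊log₂[2^n]⌋≡n (h ∸ 1))) ⟩
    suc ⌊log₂ 2 ^ (h ∸ 1) ⌋ ≤⟨ s≤s (⌊log₂⌋-mono-≤ 2^h-1≤j) ⟩
    level j                 ∎
    where open ≤-Reasoning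

  internal-query : ∀ l m → 1 ≤ m → level m < h → queriedNode l ≡ m → FunQuery l m
  internal-query (inj₁ (fvar i 1≤i i< a b)) m _ _ refl =
    record { 1≤p = 1≤i ; p< = i< ; arg₁ = a ; arg₂ = b ; is-query = refl }
  internal-query (inj₁ (lvar i 2^h-1≤i _)) m _ lm<h refl = ⊥-elim (<⇒≱ lm<h (leaf-level i 2^h-1≤i))
  internal-query (inj₂ _) m 1≤m _ refl = ⊥-elim (<⇒≱ 1≤m z≤n)

  query-at : ∀ {s s' p} → s ≡ s' → FunQuery (label P s) p → FunQuery (label P s') p
  query-at same q = record { FunQuery q ; is-query = trans (cong (label P) (sym same)) (FunQuery.is-query q) }

  arg : Fin k → Fin k → Side → Fin k
  arg a b L = a
  arg a b R = b

  thrifty-arg : ∀ I t p (q : FunQuery (label P (run P I t)) p) → ∀ s →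
                arg (FunQuery.arg₁ q) (FunQuery.arg₂ q) s ≡ val h I (child p s)
  thrifty-arg I t p record { 1≤p = 1≤p ; p< = p< ; is-query = eq } L = proj₁ (thrifty I t p 1≤p p< _ _ eq)
  thrifty-arg I t p record { 1≤p = 1≤p ; p< = p< ; is-query = eq } R = proj₂ (thrifty I t p 1≤p p< _ _ eq)

  same-query-children : ∀ X Y tX tY p → run P X tX ≡ run P Y tY →
                        FunQuery (label P (run P X tX)) p → ∀ s →
                        val h X (child p s) ≡ val h Y (child p s)
  same-query-children X Y tX tY p same q s =
    trans (sym (thrifty-arg X tX p q s)) (thrifty-arg Y tY p (query-at same q) s)

  query-valuePos : ∀ X t x Y m → 1 ≤ m → label P (run P X t) ≡ inj₁ x →
                   pos x ≡ valuePos Y m → read X x ≡ val h X m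
  query-valuePos X t x Y m 1≤m eq px with level m <? h
  query-valuePos X t (fvar _ 1≤m' m< a b) Y m 1≤m eq refl | yes lm<h =
    sym (trans (val-internal X m 1≤m lm<h)
               (sym (cong₂ (fun X m) (proj₁ (thrifty X t m 1≤m' m< a b eq)) (proj₂ (thrifty X t m 1≤m' m< a b eq)))))
  query-valuePos X t (lvar _ _ _) Y m 1≤m eq refl | no lm≮h = sym (val-leaf X m (≮⇒≥ lm≮h))

  flipNode : Instance k → ℕ → Instance k
  flipNode I m = modify I (valuePos I m) (flip (get I (valuePos I m)))

  val-flipNode : ∀ I m → 1 ≤ m → val h (flipNode I m) m ≡ flip (val h I m)
  val-flipNode I m 1≤m = begin
    val h (flipNode I m) m               ≡⟨ val-valuePos-above (flipNode I m) I m 1≤m agree ⟩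
    get (flipNode I m) (valuePos I m)    ≡⟨ get-modify-same I (valuePos I m) _ ⟩
    flip (get I (valuePos I m))          ≡⟨ cong flip (sym (val-valuePos-above I I m 1≤m (λ _ _ → refl))) ⟩
    flip (val h I m)                     ∎
    where
    open ≡-Reasoning
    agree : AgreeAbove (flipNode I m) I m
    agree = subst (AgreeAbove (flipNode I m) I) (posNode-valuePos I m)
                  (modify-agreeAbove I (valuePos I m) _)

  flipNode-unqueried : ∀ I m u → (∀ w → w < u → queriedNode (label P (run P I w)) ≢ m) →
                       run P I u ≡ run P (flipNode I m) u
  flipNode-unqueried I m u unqueried =
    modify-unqueried I (valuePos I m) _ u (λ w w<u e → unqueried w w<u (trans e (posNode-valuePos I m)))

  -- A thrifty program queries a node before it queries the function of
  -- its parent: otherwise flipping the node's value leaves the query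
  -- unchanged, yet thriftiness forces its argument to change.
  child-before-parent : ∀ I u p → FunQuery (label P (run P I u)) p → ∀ s →
                        ∃ λ w → w < u × queriedNode (label P (run P I w)) ≡ child p s
  child-before-parent I u p q s
    with anyUpTo? (λ w → queriedNode (label P (run P I w)) ℕ≟ child p s) u
  ... | yes found = found
  ... | no none = ⊥-elim (flip-≢ (val h I c) (begin
    flip (val h I c)    ≡⟨ sym (val-flipNode I c (child-pos p s (FunQuery.1≤p q))) ⟩
    val h I′ c          ≡⟨ sym (thrifty-arg I′ u p q′ s) ⟩
    arg _ _ s           ≡⟨ thrifty-arg I u p q s ⟩
    val h I c           ∎))
    where
    open ≡-Reasoning
    c  = child p s
    I′ = flipNode I c
    q′ : FunQuery (label P (run P I′ u)) p
    q′ = query-at (flipNode-unqueried I c u (λ w w<u e → none (w , w<u , e))) q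

  flip-answer : ∀ x → ⌊ flip x F≟ zero ⌋ ≢ ⌊ x F≟ zero ⌋
  flip-answer zero    ()
  flip-answer (suc _) ()

  -- A program solving BT^h_2(k) queries the root function f_1:
  -- otherwise flipping v_1 changes the answer but not the computation.
  root-queried : ∀ I → ∃ λ T → FunQuery (label P (run P I T)) 1
  root-queried I with solves I
  ... | t , answer with anyUpTo? (λ w → queriedNode (label P (run P I w)) ℕ≟ 1) t
  ...   | yes (w , _ , e) = w , internal-query _ 1 ≤-refl 2≤h e
  ...   | no none = ⊥-elim (flip-answer (val h I 1) (begin
    ⌊ flip (val h I 1) F≟ zero ⌋   ≡⟨ cong (λ x → ⌊ x F≟ zero ⌋) (sym (val-flipNode I 1 ≤-refl)) ⟩
    BT h I′                        ≡⟨ answer-unique I′ (proj₁ (solves I′)) t (proj₂ (solves I′)) answer′ ⟩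
    BT h I                         ∎))
    where
    open ≡-Reasoning
    I′ = flipNode I 1
    answer′ : label P (run P I′ t) ≡ inj₂ (BT h I)
    answer′ = trans (cong (label P) (sym (flipNode-unqueried I 1 t (λ w w<t e → none (w , w<t , e))))) answer

  -- A pebble (p , s) stands for the child c = child p s of p.  On input
  -- X it is held from time t until time u if f_p is queried at time u ≥ t
  -- while c is not queried during [t, u]: thriftiness then makes the
  -- state at time t determine v_c.
  Pebble : Set
  Pebble = ℕ × Side

  pebbleNode : Pebble → ℕ
  pebbleNode (p , s) = child p s

  Unqueried : Instance k → ℕ → ℕ → ℕ → Set
  Unqueried X c t u = ∀ {w} → w < suc u → t ≤ w → queriedNode (label P (run P X w)) ≢ c

  HeldUntil : Instance k → ℕ → Pebble → ℕ → Set
  HeldUntil X t (p , s) u = t ≤ u × FunQuery (label P (run P X u)) p × Unqueried X (child p s) t u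

  heldUntil? : ∀ X t π u → Dec (HeldUntil X t π u)
  heldUntil? X t (p , s) u =
    (t ≤? u) ×-dec funQuery? _ p ×-dec
    allUpTo? (λ w → (t ≤? w) →-dec ¬? (queriedNode (label P (run P X w)) ℕ≟ child p s)) (suc u)

  Held : Instance k → ℕ → Pebble → Set
  Held X t π = ∃ (HeldUntil X t π)

  held< : ∀ {X t π} → Held X t π → pebbleNode π < 2 * 2 ^ (h ∸ 1)
  held< {π = p , s} (_ , _ , q , _) = child< p s (FunQuery.p< q)

  module Lockstep (X Y : Instance k) (tX tY : ℕ) (same : run P X tX ≡ run P Y tY) where

    Together : ℕ → Set
    Together σ = ∀ w → w ≤ σ → run P X (tX + w) ≡ run P Y (tY + w)

    -- A query, made in step, to the value position of a pebble held by
    -- X is answered alike: the pebble's deadline u lies before the query,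
    -- and at u both computations made the same query to its parent.
    pebble-query-agrees : ∀ σ → Together σ → ∀ x → label P (run P X (tX + σ)) ≡ inj₁ x →
                          ∀ π → Held X tX π → pos x ≡ valuePos X (pebbleNode π) →
                          read X x ≡ read Y x
    pebble-query-agrees σ together x query (p , s) (u , tX≤u , q , unqueried) px = begin
      read X x            ≡⟨ query-valuePos X (tX + σ) x X c 1≤c query px ⟩
      val h X c           ≡⟨ same-query-children X Y (tX + e) (tY + e) p (together e (<⇒≤ e<σ)) q′ s ⟩
      val h Y c           ≡⟨ sym (query-valuePos Y (tY + σ) x X c 1≤c queryY px) ⟩
      read Y x            ∎
      where
      open ≡-Reasoning
      c   = child p s
      1≤c = child-pos p s (FunQuery.1≤p q)
      e   = u ∸ tX
      u≡tX+e : u ≡ tX + e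
      u≡tX+e = sym (m+[n∸m]≡n tX≤u)
      queryY : label P (run P Y (tY + σ)) ≡ inj₁ x
      queryY = trans (cong (label P) (sym (together σ ≤-refl))) query
      q′ : FunQuery (label P (run P X (tX + e))) p
      q′ = query-at (cong (run P X) u≡tX+e) q
      u<tX+σ : u < tX + σ
      u<tX+σ with suc u ≤? tX + σ
      ... | yes u<  = u<
      ... | no  u≮ = ⊥-elim (unqueried (≰⇒> u≮) (m≤m+n tX σ)
                       (trans (cong queriedNode query)
                         (trans (queriedNode-pos x) (trans (cong posNode px) (posNode-valuePos X c)))))
      e<σ : e < σ
      e<σ = +-cancelˡ-< tX e σ (subst (_< tX + σ) u≡tX+e u<tX+σ)

    together-forever : (∀ σ → Together σ → AgreeAt X Y (run P X (tX + σ))) →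
                       ∀ d → run P X (tX + d) ≡ run P Y (tY + d)
    together-forever agree = <-rec _ λ d earlier →
      stay-together X Y tX tY d same (λ v v<d → agree v (λ w w≤v → earlier (≤-<-trans w≤v v<d)))

    -- Then X and Y agree at the value position of a pebble held by X
    -- once they agree strictly below it: at the deadline both query its
    -- parent with the same arguments.
    pebble-agrees : (∀ d → run P X (tX + d) ≡ run P Y (tY + d)) →
                    ∀ π → Held X tX π → AgreeAbove X Y (pebbleNode π) →
                    get X (valuePos X (pebbleNode π)) ≡ get Y (valuePos X (pebbleNode π))
    pebble-agrees forever (p , s) (u , tX≤u , q , _) above = begin
      get X (valuePos X c)   ≡⟨ sym (val-valuePos-above X X c 1≤c (λ _ _ → refl)) ⟩
      val h X c              ≡⟨ same-query-children X Y (tX + e) (tY + e) p (forever e) q′ s ⟩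
      val h Y c              ≡⟨ val-valuePos-above Y X c 1≤c (λ r c<r → sym (above r c<r)) ⟩
      get Y (valuePos X c)   ∎
      where
      open ≡-Reasoning
      c   = child p s
      1≤c = child-pos p s (FunQuery.1≤p q)
      e   = u ∸ tX
      q′ : FunQuery (label P (run P X (tX + e))) p
      q′ = query-at (cong (run P X) (sym (m+[n∸m]≡n tX≤u))) q

  nodeBound : ℕ
  nodeBound = 2 * 2 ^ (h ∸ 1)

  PebblePos : Instance k → ℕ → Pos → Set
  PebblePos X t p = ∃ λ π → Held X t π × p ≡ valuePos X (pebbleNode π)

  pebblePos< : ∀ {X t p} → PebblePos X t p → posNode p < nodeBound
  pebblePos< {X} (π , held , refl) = subst (_< nodeBound) (sym (posNode-valuePos X (pebbleNode π))) (held< {π = π} held)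

  -- First, every query is answered alike, so the
  -- computations stay together forever; then, by downward induction on
  -- the node, every pebble's value position agrees.
  agreement : ∀ X Y tX tY → run P X tX ≡ run P Y tY →
              (∀ p → get X p ≢ get Y p → PebblePos X tX p ⊎ PebblePos Y tY p) →
              ∀ p → get X p ≡ get Y p
  agreement X Y tX tY same differ⇒pebble p = agree-from nodeBound p (≤-trans (≤-reflexive (n∸n≡0 nodeBound)) z≤n)
    where
    module XY = Lockstep X Y tX tY same
    module YX = Lockstep Y X tY tX (sym same)

    queries-agree : ∀ σ → XY.Together σ → AgreeAt X Y (run P X (tX + σ))
    queries-agree σ together x query with read X x F≟ read Y x
    ... | yes eq = eq
    ... | no neq with differ⇒pebble (pos x) (λ e → neq (trans (read-pos X x) (trans e (sym (read-pos Y x)))))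
    ...   | inj₁ (π , held , px) = XY.pebble-query-agrees σ together x query π held px
    ...   | inj₂ (π , held , px) =
      sym (YX.pebble-query-agrees σ (λ w w≤σ → sym (together w w≤σ)) x queryY π held px)
      where
      queryY : label P (run P Y (tY + σ)) ≡ inj₁ x
      queryY = trans (cong (label P) (sym (together σ ≤-refl))) query

    forever : ∀ d → run P X (tX + d) ≡ run P Y (tY + d)
    forever = XY.together-forever queries-agree

    -- the nodes strictly below a pebble at the value position p are
    -- numbered above p, one more step down the induction
    raise : ∀ Z {d c q} → nodeBound ∸ suc d ≤ posNode (valuePos Z c) → c < q → nodeBound ∸ d ≤ q
    raise Z {d} {c} bound c<q =
      ≤-trans (∸-suc-≤ nodeBound d) (≤-trans (s≤s (subst (nodeBound ∸ suc d ≤_) (posNode-valuePos Z c) bound)) c<q)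

    agree-from : ∀ d p → nodeBound ∸ d ≤ posNode p → get X p ≡ get Y p
    agree-from zero p bound = decidable-stable (get X p F≟ get Y p) λ neq →
      [ (λ pb → <⇒≱ (pebblePos< pb) bound) , (λ pb → <⇒≱ (pebblePos< pb) bound) ] (differ⇒pebble p neq)
    agree-from (suc d) p bound = decidable-stable (get X p F≟ get Y p) λ neq →
      [ pebbleX neq , pebbleY neq ] (differ⇒pebble p neq)
      where
      pebbleX : get X p ≢ get Y p → PebblePos X tX p → ⊥
      pebbleX neq (π , held , refl) =
        neq (XY.pebble-agrees forever π held (λ q c<q → agree-from d q (raise X bound c<q)))
      pebbleY : get X p ≢ get Y p → PebblePos Y tY p → ⊥
      pebbleY neq (π , held , refl) =
        neq (sym (YX.pebble-agrees (λ e → sym (forever e)) π held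
                   (λ q c<q → sym (agree-from d q (raise Y bound c<q)))))

  Distinct : ∀ {m} → Vec Pebble m → Set
  Distinct πs = ∀ j j′ → pebbleNode (lookup πs j) ≡ pebbleNode (lookup πs j′) → j ≡ j′

  h≡2+[h∸2] : 2 + (h ∸ 2) ≡ h
  h≡2+[h∸2] = trans (+-comm 2 (h ∸ 2)) (m∸n+n≡m 2≤h)

  -- Let T be a time at which the
  -- root function is queried.  The subtree of depth r at node i is
  -- covered at time t if i carries a pebble held at t (with deadline at
  -- most T), or both subtrees of its children are covered.  Nothing is
  -- covered at time 0, while after T the root itself counts as covered;
  -- at the critical time t the root's subtree becomes covered, and then
  -- h pebbles with distinct nodes are held at time t.
  module Critical (I : Instance k) where

    T : ℕ
    T = proj₁ (root-queried I)

    -- held with a deadline at most T (a decidable notion)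
    HeldByT : ℕ → Pebble → Set
    HeldByT t π = ∃ λ u → u < suc T × HeldUntil I t π u

    heldByT? : ∀ t π → Dec (HeldByT t π)
    heldByT? t π = anyUpTo? (heldUntil? I t π) (suc T)

    -- the argument `here` says whether node i itself carries a pebble
    Covered : ℕ → ℕ → ℕ → Set → Set
    Covered t zero    i here = here
    Covered t (suc r) i here =
      here ⊎ (Covered t r (child i L) (HeldByT t (i , L)) × Covered t r (child i R) (HeldByT t (i , R)))

    covered? : ∀ t r i {here} → Dec here → Dec (Covered t r i here)
    covered? t zero    i here? = here?
    covered? t (suc r) i here? =
      here? ⊎-dec (covered? t r (child i L) (heldByT? t (i , L)) ×-dec covered? t r (child i R) (heldByT? t (i , R)))

    covered-here : ∀ t r i {here} → here → Covered t r i here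
    covered-here t zero    i x = x
    covered-here t (suc r) i x = inj₁ x

    -- nothing is held at time 0, since children are queried before parents
    nothing-held-at-0 : ∀ π → ¬ HeldByT 0 π
    nothing-held-at-0 (p , s) (u , _ , _ , q , unqueried) with child-before-parent I u p q s
    ... | w , w<u , queried = unqueried (m≤n⇒m≤1+n w<u) z≤n queried

    uncovered-at-0 : ∀ r i {here} → ¬ here → ¬ Covered 0 r i here
    uncovered-at-0 zero    i ¬here c               = ¬here c
    uncovered-at-0 (suc r) i ¬here (inj₁ c)        = ¬here c
    uncovered-at-0 (suc r) i ¬here (inj₂ (cL , _)) = uncovered-at-0 r (child i L) (nothing-held-at-0 (i , L)) cL

    -- the whole tree above the leaves, counting the root as pebbled after T
    RootCovered : ℕ → Set
    RootCovered t = Covered t (h ∸ 2) 1 (T < t)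

    critical : ∃ λ t → t < suc T × ¬ RootCovered t × RootCovered (suc t)
    critical = switch (λ t → covered? t (h ∸ 2) 1 (T <? t)) (suc T)
                      (uncovered-at-0 (h ∸ 2) 1 λ ()) (covered-here (suc T) (h ∸ 2) 1 ≤-refl)

    module At (t : ℕ) (t≤T : t < suc T) where

      q : ℕ
      q = queriedNode (label P (run P I t))

      held-step : ∀ p s → HeldByT (suc t) (p , s) → HeldByT t (p , s) ⊎ child p s ≡ q
      held-step p s (u , u≤T , t<u , query , unqueried) with q ℕ≟ child p s
      ... | yes q≡c = inj₂ (sym q≡c)
      ... | no  q≢c = inj₁ (u , u≤T , <⇒≤ t<u , query , unqueried′)
        where
        unqueried′ : Unqueried I (child p s) t u
        unqueried′ w<su t≤w with m≤n⇒m<n∨m≡n t≤w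
        ... | inj₁ t<w  = unqueried w<su t<w
        ... | inj₂ refl = q≢c

      held-at-query : ∀ i → FunQuery (label P (run P I t)) i → ∀ s → HeldByT t (i , s)
      held-at-query i query s = t , t≤T , ≤-refl , query , unqueried
        where
        unqueried : Unqueried I (child i s) t t
        unqueried w<st t≤w e with ≤-antisym (≤-pred w<st) t≤w
        ... | refl = <-irrefl (trans (sym (queriedNode-funQuery query)) e)
                              (parent<child i s (FunQuery.1≤p query))

      record Pebbling (r i : ℕ) : Set where
        field
          pebbles  : Vec Pebble (suc (suc r))
          held     : ∀ j → HeldByT t (lookup pebbles j)
          inside   : ∀ j → ∃ λ d → Desc (pebbleNode (lookup pebbles j)) (suc d) i
          distinct : Distinct pebbles
          q-inside : Desc q r i

      InCovered : ℕ → ℕ → Side → Set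
      InCovered r p s = Σ Pebble λ π → HeldByT t π × ∃ λ d → Desc (pebbleNode π) d (child p s)

      pick : ∀ r p s → Covered t r (child p s) (HeldByT t (p , s)) → InCovered r p s
      pick zero    p s held                    = (p , s) , held , 0 , refl
      pick (suc r) p s (inj₁ held)             = (p , s) , held , 0 , refl
      pick (suc r) p s (inj₂ (coveredL , _)) with pick r (child p s) L coveredL
      ... | π , held , d , inside = π , held , suc d , L , inside

      extend : ∀ r i s → 1 ≤ i → InCovered r i s → Pebbling r (child i (opposite s)) → Pebbling (suc r) i
      extend r i s 1≤i (π , heldπ , dπ , insideπ) ρ = record
        { pebbles  = π ∷ pebbles
        ; held     = λ { zero → heldπ ; (suc j) → held j }
        ; inside   = λ { zero → dπ , s , insideπ
                       ; (suc j) → suc (proj₁ (inside j)) , opposite s , proj₂ (inside j) }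
        ; distinct = distinct′
        ; q-inside = opposite s , q-inside
        }
        where
        open Pebbling ρ
        apart : ∀ j → pebbleNode π ≢ pebbleNode (lookup pebbles j)
        apart j e = subtrees-disjoint {d = dπ} {d' = suc (proj₁ (inside j))} 1≤i (opposite-≢ s) insideπ
                      (subst (λ c → Desc c (suc (proj₁ (inside j))) (child i (opposite s))) (sym e) (proj₂ (inside j)))
        distinct′ : Distinct (π ∷ pebbles)
        distinct′ zero    zero     _ = refl
        distinct′ zero    (suc j′) e = ⊥-elim (apart j′ e)
        distinct′ (suc j) zero     e = ⊥-elim (apart j (sym e))
        distinct′ (suc j) (suc j′) e = cong suc (distinct j j′ e)

      level-down : ∀ i s r → 1 ≤ i → level i + suc (suc r) ≡ h → level (child i s) + suc r ≡ h
      level-down i s r 1≤i e = trans (cong (_+ suc r) (level-child i s 1≤i)) (trans (sym (+-suc (level i) (suc r))) e)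

      above-leaves : ∀ i r → level i + suc r ≡ h → level i < h
      above-leaves i r e = subst (level i <_) e (m<m+n (level i) (s≤s z≤n))

      -- Suppose the subtree of depth r at i, reaching down
      -- to the level above the leaves, is uncovered at t but covered at
      -- t+1, where the pebble `here₁` at i at time t+1 was `here₀` at time
      -- t unless i is queried at t.  Then q lies in that subtree, and a
      -- pebbling of r + 2 held pebbles inside it exists: if i = q both
      -- children of i are held; otherwise q lies below the one child whose
      -- subtree became covered, and the other child's subtree was already
      -- covered and supplies one more pebble.
      pebbling : ∀ r i {here₀ here₁ : Set} → 1 ≤ i → level i + suc r ≡ h →
                 (here₁ → here₀ ⊎ i ≡ q) → Covered (suc t) r i here₁ → ¬ Covered t r i here₀ →
                 Pebbling r i
      pebbling zero i 1≤i lv step covered₁ uncovered₀ with i ℕ≟ q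
      ... | yes refl = record
        { pebbles  = (q , L) ∷ (q , R) ∷ []
        ; held     = λ { zero → held-at-query q query L ; (suc zero) → held-at-query q query R }
        ; inside   = λ { zero → 0 , L , refl ; (suc zero) → 0 , R , refl }
        ; distinct = λ { zero zero _ → refl
                       ; zero (suc zero) e → ⊥-elim (opposite-≢ L (proj₂ (child-injective q q L R e)))
                       ; (suc zero) zero e → ⊥-elim (opposite-≢ R (proj₂ (child-injective q q R L e)))
                       ; (suc zero) (suc zero) _ → refl }
        ; q-inside = refl
        }
        where
        query : FunQuery (label P (run P I t)) q
        query = internal-query _ q 1≤i (above-leaves q 0 lv) refl
      ... | no i≢q = ⊥-elim ([ uncovered₀ , i≢q ] (step covered₁))
      pebbling (suc r) i 1≤i lv step covered₁ uncovered₀ with i ℕ≟ q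
      ... | yes refl = ⊥-elim (uncovered₀ (inj₂ (covered-here t r _ (held-at-query q query L) ,
                                                 covered-here t r _ (held-at-query q query R))))
        where
        query : FunQuery (label P (run P I t)) q
        query = internal-query _ q 1≤i (above-leaves q (suc r) lv) refl
      ... | no i≢q with covered₁
      ...   | inj₁ here₁ = ⊥-elim ([ (λ here₀ → uncovered₀ (inj₁ here₀)) , i≢q ] (step here₁))
      ...   | inj₂ (covered₁L , covered₁R)
              with covered? t r (child i L) (heldByT? t (i , L)) | covered? t r (child i R) (heldByT? t (i , R))
      ...     | yes coveredL | yes coveredR = ⊥-elim (uncovered₀ (inj₂ (coveredL , coveredR)))
      ...     | yes coveredL | no uncoveredR = extend r i L 1≤i (pick r i L coveredL)
        (pebbling r (child i R) (child-pos i R 1≤i) (level-down i R r 1≤i lv) (held-step i R) covered₁R uncoveredR)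
      ...     | no uncoveredL | yes coveredR = extend r i R 1≤i (pick r i R coveredR)
        (pebbling r (child i L) (child-pos i L 1≤i) (level-down i L r 1≤i lv) (held-step i L) covered₁L uncoveredL)
      ...     | no uncoveredL | no uncoveredR = ⊥-elim (subtrees-disjoint {d = r} {d' = r} 1≤i (opposite-≢ L)
        (Pebbling.q-inside (pebbling r (child i L) (child-pos i L 1≤i) (level-down i L r 1≤i lv) (held-step i L) covered₁L uncoveredL))
        (Pebbling.q-inside (pebbling r (child i R) (child-pos i R 1≤i) (level-down i R r 1≤i lv) (held-step i R) covered₁R uncoveredR)))

    critical-pebbling : ∃ λ t → Σ (Vec Pebble (2 + (h ∸ 2))) λ πs → (∀ j → Held I t (lookup πs j)) × Distinct πs
    critical-pebbling with critical
    ... | t , t≤T , uncovered , covered = t , pebbles , (λ j → unbound {lookup pebbles j} (held j)) , distinct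
      where
      open At t t≤T
      root-step : T < suc t → T < t ⊎ 1 ≡ q
      root-step T<t+1 with m≤n⇒m<n∨m≡n (≤-pred T<t+1)
      ... | inj₁ T<t  = inj₁ T<t
      ... | inj₂ refl = inj₂ (sym (queriedNode-funQuery (proj₂ (root-queried I))))
      open Pebbling (pebbling (h ∸ 2) 1 ≤-refl h≡2+[h∸2] root-step covered uncovered)
      unbound : ∀ {π} → HeldByT t π → Held I t π
      unbound (u , _ , heldUntil) = u , heldUntil

  -- Inputs restricted to the nodes below nodeBound, as finite data: for
  -- each node its function table and its leaf label.
  Cell : Set
  Cell = Vec (Vec (Fin k) k) k × Fin k

  Store : Set
  Store = Vec Cell nodeBound

  blank : Cell
  blank = replicate k (replicate k zero) , zero

  cell : Store → ℕ → Cell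
  cell α i = atℕ blank α i

  cellEntry : Pos → Cell → Fin k
  cellEntry (fpos _ a b) (F , _) = lookup (lookup F a) b
  cellEntry (lpos _)     (_ , ℓ) = ℓ

  writeCell : Pos → Fin k → Cell → Cell
  writeCell (fpos _ a b) v (F , ℓ) = updateAt F a (_[ b ]≔ v) , ℓ
  writeCell (lpos _)     v (F , _) = F , v

  cellEntry-writeCell : ∀ p v c → cellEntry p (writeCell p v c) ≡ v
  cellEntry-writeCell (fpos _ a b) v (F , _) = trans (cong (λ row → lookup row b) (lookup∘updateAt a {_[ b ]≔ v} F)) (lookup∘update b (lookup F a) v)
  cellEntry-writeCell (lpos _)     v (F , _) = refl

  cellEntry-writeCell′ : ∀ p v c p′ → p′ ≢ p → posNode p′ ≡ posNode p → cellEntry p′ (writeCell p v c) ≡ cellEntry p′ c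
  cellEntry-writeCell′ (fpos i a b) v (F , ℓ) (fpos .i a′ b′) p′≢p refl with a′ F≟ a
  ... | no a′≢a  = cong (λ row → lookup row b′) (lookup∘updateAt′ a′ a {_[ b ]≔ v} a′≢a F)
  ... | yes refl = trans (cong (λ row → lookup row b′) (lookup∘updateAt a {_[ b ]≔ v} F))
                         (lookup∘update′ (λ b′≡b → p′≢p (cong (fpos i a) b′≡b)) (lookup F a) v)
  cellEntry-writeCell′ (fpos _ _ _) v (F , ℓ) (lpos _)       _    _    = refl
  cellEntry-writeCell′ (lpos _)     v (F , ℓ) (fpos _ _ _)   _    _    = refl
  cellEntry-writeCell′ (lpos i)     v (F , ℓ) (lpos .i)      p′≢p refl = ⊥-elim (p′≢p refl)

  entry : Store → Pos → Fin k
  entry α p = cellEntry p (cell α (posNode p))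

  write : Store → Pos → Fin k → Store
  write α p v = updateAtℕ α (posNode p) (writeCell p v)

  input : Store → Instance k
  input α = record { fun = λ i a b → entry α (fpos i a b) ; leaf = λ i → entry α (lpos i) }

  get-input : ∀ α p → get (input α) p ≡ entry α p
  get-input α (fpos _ _ _) = refl
  get-input α (lpos _)     = refl

  entry-write : ∀ α p v → posNode p < nodeBound → entry (write α p v) p ≡ v
  entry-write α p v p< = trans (cong (cellEntry p) (atℕ-updateAtℕ blank α (posNode p) (writeCell p v) p<))
                               (cellEntry-writeCell p v _)

  entry-write′ : ∀ α p v p′ → posNode p < nodeBound → p′ ≢ p → entry (write α p v) p′ ≡ entry α p′
  entry-write′ α p v p′ p< p′≢p with posNode p′ ℕ≟ posNode p
  ... | no  i′≢i = cong (cellEntry p′) (atℕ-updateAtℕ′ blank α (posNode p) (posNode p′) (writeCell p v) i′≢i)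
  ... | yes i′≡i = begin
    cellEntry p′ (cell (write α p v) (posNode p′))   ≡⟨ cong (cellEntry p′ ∘ cell (write α p v)) i′≡i ⟩
    cellEntry p′ (cell (write α p v) (posNode p))    ≡⟨ cong (cellEntry p′) (atℕ-updateAtℕ blank α (posNode p) (writeCell p v) p<) ⟩
    cellEntry p′ (writeCell p v (cell α (posNode p))) ≡⟨ cellEntry-writeCell′ p v _ p′ p′≢p i′≡i ⟩
    cellEntry p′ (cell α (posNode p))                ≡⟨ cong (cellEntry p′ ∘ cell α) (sym i′≡i) ⟩
    cellEntry p′ (cell α (posNode p′))               ∎
    where open ≡-Reasoning

  store-ext : ∀ α β → (∀ p → entry α p ≡ entry β p) → α ≡ β
  store-ext α β eq = atℕ-ext blank α β λ i _ → cong₂ _,_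
    (lookup-ext _ _ λ a → lookup-ext _ _ λ b → eq (fpos i a b)) (eq (lpos i))

  store↔ : Store ↔ Fin (((k ^ k) ^ k * k) ^ nodeBound)
  store↔ = Vec↔Fin nodeBound (×↔Fin (Vec↔Fin k (Vec↔Fin k ↔-refl)) ↔-refl)

  writeAll : Store → ∀ {m} → Vec Pos m → Vec (Fin k) m → Store
  writeAll α []       []       = α
  writeAll α (p ∷ ps) (v ∷ vs) = write (writeAll α ps vs) p v

  writeAll-outside : ∀ α {m} (ps : Vec Pos m) vs p → (∀ j → posNode (lookup ps j) < nodeBound) →
                     (∀ j → p ≢ lookup ps j) → entry (writeAll α ps vs) p ≡ entry α p
  writeAll-outside α []       []       p _      _   = refl
  writeAll-outside α (q ∷ ps) (v ∷ vs) p bounds p∉ =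
    trans (entry-write′ (writeAll α ps vs) q v p (bounds zero) (p∉ zero))
          (writeAll-outside α ps vs p (bounds ∘ suc) (p∉ ∘ suc))

  writeAll-inside : ∀ α {m} (ps : Vec Pos m) vs → (∀ j → posNode (lookup ps j) < nodeBound) →
                    (∀ j j′ → lookup ps j ≡ lookup ps j′ → j ≡ j′) →
                    ∀ j → entry (writeAll α ps vs) (lookup ps j) ≡ lookup vs j
  writeAll-inside α (q ∷ ps) (v ∷ vs) bounds distinct zero = entry-write (writeAll α ps vs) q v (bounds zero)
  writeAll-inside α (q ∷ ps) (v ∷ vs) bounds distinct (suc j) =
    trans (entry-write′ (writeAll α ps vs) q v (lookup ps j) (bounds zero) (λ e → 0≢suc (distinct zero (suc j) (sym e))))
          (writeAll-inside α ps vs (bounds ∘ suc) (λ j j′ e → Fin-suc-injective (distinct (suc j) (suc j′) e)) j)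
    where
    0≢suc : zero ≢ suc j
    0≢suc ()

  H : ℕ
  H = 2 + (h ∸ 2)

  -- The critical time and critical pebbles of the input of a store.
  -- Kept abstract: only this specification is used, and unfolding the
  -- construction would make type checking much slower.
  abstract
    criticalOf : (α : Store) → ∃ λ t → Σ (Vec Pebble H) λ πs →
                 (∀ j → Held (input α) t (lookup πs j)) × Distinct πs
    criticalOf α = Critical.critical-pebbling (input α)

  timeOf : Store → ℕ
  timeOf α = proj₁ (criticalOf α)

  pebblesOf : Store → Vec Pebble H
  pebblesOf α = proj₁ (proj₂ (criticalOf α))

  slots : Store → Vec Pos H
  slots α = map (valuePos (input α) ∘ pebbleNode) (pebblesOf α)

  slot-pebblePos : ∀ α j → PebblePos (input α) (timeOf α) (lookup (slots α) j)
  slot-pebblePos α j = lookup (pebblesOf α) j , proj₁ (proj₂ (proj₂ (criticalOf α))) j ,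
                       lookup-map j (valuePos (input α) ∘ pebbleNode) (pebblesOf α)

  slots-bounded : ∀ α j → posNode (lookup (slots α) j) < nodeBound
  slots-bounded α j = pebblePos< (slot-pebblePos α j)

  slots-distinct : ∀ α j j′ → lookup (slots α) j ≡ lookup (slots α) j′ → j ≡ j′
  slots-distinct α j j′ e = proj₂ (proj₂ (proj₂ (criticalOf α))) j j′ (begin
    pebbleNode (lookup (pebblesOf α) j)                 ≡⟨ sym (posNode-valuePos (input α) _) ⟩
    posNode (valuePos (input α) (pebbleNode (lookup (pebblesOf α) j)))
      ≡⟨ cong posNode (trans (sym (lookup-map j _ (pebblesOf α))) (trans e (lookup-map j′ _ (pebblesOf α)))) ⟩
    posNode (valuePos (input α) (pebbleNode (lookup (pebblesOf α) j′)))  ≡⟨ posNode-valuePos (input α) _ ⟩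
    pebbleNode (lookup (pebblesOf α) j′)                ∎)
    where open ≡-Reasoning

  Φ : Store × Vec (Fin k) H → Fin n × Store
  Φ (α , vs) = run P (input α) (timeOf α) , writeAll α (slots α) vs

  -- By the agreement lemma, the state and the rewritten store determine
  -- the store: two stores with the same image differ only at critical
  -- pebble positions.
  Φ-store : ∀ {α vs β ws} → Φ (α , vs) ≡ Φ (β , ws) → α ≡ β
  Φ-store {α} {vs} {β} {ws} e =
    store-ext α β (λ p → trans (sym (get-input α p)) (trans (inputs-agree p) (get-input β p)))
    where
    rewritten : writeAll α (slots α) vs ≡ writeAll β (slots β) ws
    rewritten = cong proj₂ e
    differ⇒pebble : ∀ p → get (input α) p ≢ get (input β) p →
                    PebblePos (input α) (timeOf α) p ⊎ PebblePos (input β) (timeOf β) p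
    differ⇒pebble p neq with any? (λ j → p ≟P lookup (slots α) j) | any? (λ j → p ≟P lookup (slots β) j)
    ... | yes (j , refl) | _              = inj₁ (slot-pebblePos α j)
    ... | no _           | yes (j , refl) = inj₂ (slot-pebblePos β j)
    ... | no ∉α          | no ∉β          = ⊥-elim (neq (begin
      get (input α) p                    ≡⟨ get-input α p ⟩
      entry α p                          ≡⟨ sym (writeAll-outside α (slots α) vs p (slots-bounded α) (λ j e → ∉α (j , e))) ⟩
      entry (writeAll α (slots α) vs) p  ≡⟨ cong (λ γ → entry γ p) rewritten ⟩
      entry (writeAll β (slots β) ws) p  ≡⟨ writeAll-outside β (slots β) ws p (slots-bounded β) (λ j e → ∉β (j , e)) ⟩
      entry β p                          ≡⟨ sym (get-input β p) ⟩
      get (input β) p                    ∎))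
      where open ≡-Reasoning
    inputs-agree : ∀ p → get (input α) p ≡ get (input β) p
    inputs-agree = agreement (input α) (input β) (timeOf α) (timeOf β) (cong proj₁ e) differ⇒pebble

  -- Φ is injective: once the store is known, the written values are read
  -- back from the distinct critical positions.
  Φ-injective : Injective _≡_ _≡_ Φ
  Φ-injective {α , vs} {β , ws} e with Φ-store e
  ... | refl = cong (α ,_) (lookup-ext vs ws λ j → begin
    lookup vs j                                          ≡⟨ sym (read-back vs j) ⟩
    entry (writeAll α (slots α) vs) (lookup (slots α) j) ≡⟨ cong (λ γ → entry γ (lookup (slots α) j)) (cong proj₂ e) ⟩
    entry (writeAll α (slots α) ws) (lookup (slots α) j) ≡⟨ read-back ws j ⟩
    lookup ws j                                          ∎)
    where
    open ≡-Reasoning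
    read-back : ∀ us j → entry (writeAll α (slots α) us) (lookup (slots α) j) ≡ lookup us j
    read-back us = writeAll-inside α (slots α) us (slots-bounded α) (slots-distinct α)

  blankStore : Store
  blankStore = replicate nodeBound blank

theorem5p10 : (h k n : ℕ) → 2 ≤ h → 2 ≤ k → (P : BP h k n) →
    Solves P → Thrifty P → k ^ h ≤ n
theorem5p10 h (suc (suc k')) n 2≤h (s≤s (s≤s z≤n)) P solves thrifty =
  subst (λ m → suc (suc k') ^ m ≤ n) h≡2+[h∸2]
    (counting store↔ (Vec↔Fin H ↔-refl) blankStore Φ Φ-injective)
  where open LowerBound h k' n P 2≤h solves thrifty
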